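{- Suppose we run the (sequential) Resampling Algorithm, taking the values of the variables from a resampling table $R$, and it performs resamplings of bad events $B_1,\dots,B_t$ in this order. Then the Full Witness DAG $\hat G$ of this execution is compatible with $R$.
   Context: Setting: $X_1,\dots,X_n$ are independent discrete random variables; $\Omega$ their product distribution. $\mathcal B$ is a finite set of bad events, each $B$ a Boolean function of the variables in $S_B\subseteq[n]$; $B\sim B'$ iff $S_B\cap S_{B'}\ne\emptyset$. A resampling table $R$ consists of values $R(i,t)$, $i\in[n]$, $t\ge1$. Running the Resampling Algorithm with $R$: initially $X_i=R(i,1)$; while some bad event is true, choose some true $B$ arbitrarily and, for each $i\in S_B$, if this is the $k$-th time variable $i$ is resampled, set $X_i=R(i,k+1)$. A witness DAG (WD) is a finite DAG whose vertices are labeled by bad events such that for distinct vertices $v,v'$ with labels $B,B'$: if $B\sim B'$ there is an edge between them (in one direction), and if $B\not\sim B'$ there is none. For $i\in[n]$, $G[i]$ is the set of vertices whose label $B$ has $i\in S_B$. For $v$ labeled $B$ and $i\in S_B$, $y_{v,i}$ is the number of $w\in G[i]$ with an edge $w\to v$, and $X^v_G(i)=R(i,1+y_{v,i})$. $G$ is compatible with $R$ if each vertex's label is true on $X^v_G$. The Full Witness DAG $\hat G$ of an execution resampling $B_1,\dots,B_t$ has vertices $v_1,\dots,v_t$ with $v_j$ labeled $B_j$, and an edge $v_i\to v_j$ iff $i<j$ and $B_i\sim B_j$. -}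

module Defs where

open import Data.Nat using (ℕ; zero; suc; _+_; _<ᵇ_)
open import Data.Fin using (Fin; zero; suc; toℕ)
open import Data.Bool using (Bool; true; false; _∧_; _∨_; if_then_else_)
open import Data.List using (List; []; _∷_; length; lookup)
open import Data.Product using (_×_)
open import Data.Sum using (_⊎_)
open import Relation.Nullary using (¬_)
open import Relation.Binary.PropositionalEquality using (_≡_)

anyFin : ∀ {k} → (Fin k → Bool) → Bool
anyFin {zero} f = false
anyFin {suc k} f = f zero ∨ anyFin (λ i → f (suc i))

countFin : ∀ {k} → (Fin k → Bool) → ℕ
countFin {zero} f = 0
countFin {suc k} f = (if f zero then 1 else 0) + countFin (λ i → f (suc i))

record EventSystem (n m : ℕ) (V : Fin n → Set) : Set₁ where
  field
    scope : Fin m → Fin n → Bool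
    holds : Fin m → ((i : Fin n) → V i) → Bool
    local : ∀ b (σ τ : (i : Fin n) → V i) →
            (∀ i → scope b i ≡ true → σ i ≡ τ i) → holds b σ ≡ holds b τ

module _ {n m : ℕ} {V : Fin n → Set} (S : EventSystem n m V) where
  open EventSystem S

  dep : Fin m → Fin m → Bool
  dep b b' = anyFin (λ i → scope b i ∧ scope b' i)

  -- Resampling table: R i t is R(i,t); only t ≥ 1 is used.
  ResamplingTable : Set
  ResamplingTable = (i : Fin n) → ℕ → V i

  -- Counters: c i = number of times variable i has been resampled so far.
  Counters : Set
  Counters = Fin n → ℕ

  valueOf : ResamplingTable → Counters → (i : Fin n) → V i
  valueOf R c i = R i (suc (c i))

  resampleCounters : Fin m → Counters → Counters
  resampleCounters b c i = if scope b i then suc (c i) else c i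

  -- Run R c bs : starting with counters c, the Resampling Algorithm can
  -- resample the events in bs in this order (each resampled event is true
  -- in the current assignment when it is chosen).
  data Run (R : ResamplingTable) : Counters → List (Fin m) → Set where
    done : ∀ c → Run R c []
    step : ∀ c b bs → holds b (valueOf R c) ≡ true →
           Run R (resampleCounters b c) bs → Run R c (b ∷ bs)

  Executes : ResamplingTable → List (Fin m) → Set
  Executes R bs = Run R (λ _ → 0) bs

  record LabelledDigraph : Set where
    field
      size  : ℕ
      label : Fin size → Fin m
      edge  : Fin size → Fin size → Bool

  module _ (G : LabelledDigraph) where
    open LabelledDigraph G

    data Path : Fin size → Fin size → Set where
      one  : ∀ {u v} → edge u v ≡ true → Path u v
      cons : ∀ {u v w} → edge u v ≡ true → Path v w → Path u w

    IsWitnessDAG : Set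
    IsWitnessDAG =
      (∀ v → ¬ Path v v) ×
      (∀ v v' → ¬ v ≡ v' →
        (dep (label v) (label v') ≡ true → edge v v' ≡ true ⊎ edge v' v ≡ true) ×
        (dep (label v) (label v') ≡ false → edge v v' ≡ false))

    inG : Fin n → Fin size → Bool
    inG i v = scope (label v) i

    y : Fin size → Fin n → ℕ
    y v i = countFin (λ w → inG i w ∧ edge w v)

    -- X^v_G(i) = R(i, 1 + y_{v,i})  (given for all i; only i ∈ S_B matters by locality)
    XvG : ResamplingTable → Fin size → (i : Fin n) → V i
    XvG R v i = R i (suc (y v i))

    Compatible : ResamplingTable → Set
    Compatible R = ∀ v → holds (label v) (XvG R v) ≡ true

  fullWD : List (Fin m) → LabelledDigraph
  fullWD bs = record
    { size  = length bs
    ; label = lookup bs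
    ; edge  = λ i j → (toℕ i <ᵇ toℕ j) ∧ dep (lookup bs i) (lookup bs j)
    }

module Submission where

-- When the j-th resampled event B_j is chosen, variable i ∈ S_{B_j}
-- has been resampled exactly once for every earlier B_k with i ∈ S_{B_k};
-- each such B_k shares i with B_j, so it is a predecessor of v_j in G[i].
-- Hence the current value of X_i is R(i, 1 + y_{v_j,i}) = X^{v_j}(i), and
-- B_j was true there.
--
-- Since a run may start from arbitrary counters c, we prove the stronger
-- invariant by induction on the run: every run from counters c is compatible
-- with the table R shifted by c, i.e. R(i, t + c_i).  Two counting facts
-- about the Full Witness DAG drive the induction: the first vertex has no
-- predecessors, and a later vertex v_{j+1} of B ∷ Bs has the predecessors of
-- v_j in Bs plus possibly the new vertex v_0 (exactly when i ∈ S_B).  The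
-- theorem is the case c = 0, after removing the trivial shift by 0.

open import Defs
open import Data.Nat using (ℕ; suc; _+_)
open import Data.Nat.Properties using (+-suc; +-identityʳ)
open import Data.Fin using (Fin; zero; suc)
open import Data.List using (List; _∷_; lookup)
open import Data.Bool using (Bool; true; false; _∧_; if_then_else_)
open import Data.Bool.Properties using (∧-zeroʳ)
open import Relation.Binary.PropositionalEquality
  using (_≡_; refl; sym; trans; cong; module ≡-Reasoning)

countFin-false : ∀ {k} (f : Fin k → Bool) → (∀ w → f w ≡ false) → countFin f ≡ 0
countFin-false {ℕ.zero} f never = refl
countFin-false {suc k} f never rewrite never zero =
  countFin-false (λ w → f (suc w)) (λ w → never (suc w))

anyFin-true : ∀ {k} (f : Fin k → Bool) (w : Fin k) → f w ≡ true → anyFin f ≡ true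
anyFin-true f zero fw rewrite fw = refl
anyFin-true f (suc w) fw with f zero
... | true  = refl
... | false = anyFin-true (λ i → f (suc i)) w fw

module _ {n m : ℕ} {V : Fin n → Set} (S : EventSystem n m V) where
  open EventSystem S

  dep-shared : ∀ b b' i → scope b i ≡ true → scope b' i ≡ true → dep S b b' ≡ true
  dep-shared b b' i bi b'i =
    anyFin-true (λ k → scope b k ∧ scope b' k) i (both-true bi b'i)
    where
    both-true : ∀ {x y} → x ≡ true → y ≡ true → x ∧ y ≡ true
    both-true refl refl = refl

  compatible-resp : ∀ G (R R' : ResamplingTable S) → (∀ i t → R i t ≡ R' i t) →
                    Compatible S G R → Compatible S G R'
  compatible-resp G R R' R≗R' compat v =
    trans (sym (local (label v) (XvG S G R v) (XvG S G R' v) (λ i _ → R≗R' i _)))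
          (compat v)
    where open LabelledDigraph G

  shift : ResamplingTable S → Counters S → ResamplingTable S
  shift R c i t = R i (t + c i)

  first-vertex-no-predecessors : ∀ b bs i → y S (fullWD S (b ∷ bs)) zero i ≡ 0
  first-vertex-no-predecessors b bs i =
    countFin-false _ (λ w → ∧-zeroʳ (scope (lookup (b ∷ bs) w) i))

  -- For a variable i of B_j, the offset lost by moving v_{j+1} (in B ∷ Bs) to
  -- v_j (in Bs) equals the counter increment caused by resampling B.  By
  -- computation, the predecessors of v_{j+1} in G[i] are those of v_j plus v_0
  -- exactly when i ∈ S_B and B ~ B_j; the latter is automatic when i ∈ S_{B_j}.
  resampling-bookkeeping : ∀ b bs j (c : Counters S) i → scope (lookup bs j) i ≡ true →
    y S (fullWD S (b ∷ bs)) (suc j) i + c i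
      ≡ y S (fullWD S bs) j i + resampleCounters S b c i
  resampling-bookkeeping b bs j c i ij with scope b i in bi
  ... | false = refl
  ... | true  = begin
      (if dep S b (lookup bs j) then 1 else 0) + y S (fullWD S bs) j i + c i
        ≡⟨ cong (λ d → (if d then 1 else 0) + y S (fullWD S bs) j i + c i)
                (dep-shared b (lookup bs j) i bi ij) ⟩
      suc (y S (fullWD S bs) j i + c i)
        ≡⟨ sym (+-suc (y S (fullWD S bs) j i) (c i)) ⟩
      y S (fullWD S bs) j i + suc (c i)
        ∎
    where open ≡-Reasoning

  -- The
  -- first event was true at R(i, 1 + c_i); the rest is a run from the updated
  -- counters, whose shift agrees with ours on the relevant variables.
  run-compatible : ∀ R c bs → Run S R c bs → Compatible S (fullWD S bs) (shift R c)
  run-compatible R c (b ∷ bs) (step .c .b .bs b-true _) zero =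
    trans (local b _ (valueOf S R c)
                 (λ i _ → cong (λ k → R i (suc (k + c i)))
                               (first-vertex-no-predecessors b bs i)))
          b-true
  run-compatible R c (b ∷ bs) (step .c .b .bs _ rest) (suc j) =
    trans (local (lookup bs j) _ _
                 (λ i ij → cong (λ k → R i (suc k)) (resampling-bookkeeping b bs j c i ij)))
          (run-compatible R (resampleCounters S b c) bs rest j)

mainTheorem20 : ∀ {n m : ℕ} {V : Fin n → Set} (S : EventSystem n m V)
    (R : ResamplingTable S) (bs : List (Fin m)) →
    Executes S R bs → Compatible S (fullWD S bs) R
mainTheorem20 S R bs execution =
  compatible-resp S (fullWD S bs) (shift S R (λ _ → 0)) R
                  (λ i t → cong (R i) (+-identityʳ t))
                  (run-compatible S R (λ _ → 0) bs execution)
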